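{- Let $(G,\tau)$ be a signed graph and let $\mathbf{w}$ and $\mathbf{w}'$ be two closed walks in $G$ having the same first vertex term. Then $\mu(\mathbf{w}+\mathbf{w}')=\mu(\mathbf{w})\mu(\mathbf{w}')$.
   Context: Graphs are finite and simple; a sign $\tau$ of $G$ assigns $1$ or $-1$ to each pair $(e,v)$ with $v$ an endpoint of edge $e$. A walk $\mathbf{w}:v_1e_1v_2\cdots e_tv_{t+1}$ has $e_i=v_iv_{i+1}$; it is closed if $v_{t+1}=v_1$, trivial if $t=0$. $\mathbf{w}+\mathbf{w}'$ is the concatenation of $\mathbf{w}$ followed by $\mathbf{w}'$ (when the last vertex of $\mathbf{w}$ is the first of $\mathbf{w}'$). An internal vertex term $v_i$ ($1<i<t+1$) is unbalanced if $\tau(e_{i-1},v_i)\tau(e_i,v_i)=1$; if $\mathbf{w}$ is closed of length at least two, the vertex term $v_1$ is also unbalanced if $\tau(e_t,v_1)\tau(e_1,v_1)=1$. $\mu(\mathbf{w})=(-1)^k$ where $k$ is the number of unbalanced vertex terms of $\mathbf{w}$ (so $\mu=1$ for walks of length at most one). -}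

module Defs where

open import Data.Nat using (ℕ; zero; suc) renaming (_+_ to _+ℕ_)
open import Data.Fin using (Fin; _≟_)
open import Data.Sign using (Sign; +; -; _*_)
open import Relation.Binary.PropositionalEquality using (_≡_; refl)
open import Relation.Nullary using (¬_; yes; no)

-- A finite simple graph on vertex set Fin n: symmetric, irreflexive adjacency.
-- An edge is an unordered pair {u,v} with Adj u v.
record Graph : Set₁ where
  field
    n     : ℕ
    Adj   : Fin n → Fin n → Set
    sym   : ∀ {u v} → Adj u v → Adj v u
    irrefl : ∀ {u} → ¬ Adj u u

open Graph public

-- A sign of G: assigns ±1 to each pair (e , v) with v an endpoint of e.
-- Encoded as  τ u v = τ({u,v}, v)  (the sign of edge uv at its endpoint v);
-- values on non-adjacent pairs are irrelevant.
Signing : Graph → Set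
Signing G = Fin (n G) → Fin (n G) → Sign

-- Walks from u to v: v₁ e₁ v₂ ⋯ e_t v_{t+1}, with e_i = v_i v_{i+1}.
data Walk (G : Graph) : Fin (n G) → Fin (n G) → Set where
  nil  : ∀ {u} → Walk G u u
  cons : ∀ {u w v} → Adj G u w → Walk G w v → Walk G u v

length : ∀ {G u v} → Walk G u v → ℕ
length nil = 0
length (cons _ p) = suc (length p)

_++ʷ_ : ∀ {G u v x} → Walk G u v → Walk G v x → Walk G u x
nil ++ʷ q = q
cons a p ++ʷ q = cons a (p ++ʷ q)

-- 1 if the product of two signs equals 1 (i.e. the vertex term is unbalanced), else 0
unb : Sign → Sign → ℕ
unb s t with s * t
... | + = 1
... | - = 0

-- number of unbalanced internal vertex terms v_i (1 < i < t+1)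
internalUnb : ∀ {G} → Signing G → ∀ {u v} → Walk G u v → ℕ
internalUnb τ nil = 0
internalUnb τ (cons a nil) = 0
internalUnb τ (cons {u} {w} a (cons {w} {x} b p)) =
  unb (τ u w) (τ x w) +ℕ internalUnb τ (cons b p)

-- the vertex v_t preceding the last vertex of a walk x e v ⋯ (x given with first step)
lastPrev : ∀ {G} (x : Fin (n G)) {u v} → Adj G x u → Walk G u v → Fin (n G)
lastPrev x a nil = x
lastPrev x a (cons {u} b p) = lastPrev u b p

-- for a closed walk of length ≥ 2, whether v₁ is unbalanced:
-- τ(e_t, v₁) τ(e₁, v₁) = 1, where e₁ = v₁v₂ and e_t = v_t v₁
closingUnb : ∀ {G} → Signing G → ∀ {v} → Walk G v v → ℕ
closingUnb τ nil = 0
closingUnb τ (cons a nil) = 0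
closingUnb τ (cons {v} {w} a (cons b p)) = unb (τ (lastPrev v a (cons b p)) v) (τ w v)

-- k = number of unbalanced vertex terms (v₁ counted only for closed walks)
unbalancedCount : ∀ {G} → Signing G → ∀ {u v} → Walk G u v → ℕ
unbalancedCount τ {u} {v} p with u ≟ v
... | yes refl = internalUnb τ p +ℕ closingUnb τ p
... | no _ = internalUnb τ p

negOnePow : ℕ → Sign
negOnePow zero = +
negOnePow (suc k) = - * negOnePow k

μ : ∀ {G} → Signing G → ∀ {u v} → Walk G u v → Sign
μ τ p = negOnePow (unbalancedCount τ p)

-- Split w and w' at the common vertex v. The unbalanced internal terms of w + w' are those of w,
-- those of w', and the junction term of v, formed by the last edge of w and the first edge of w';
-- its closing term is formed by the last edge of w' and the first edge of w. Writing the sign of a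
-- term with incident signs s, t as −st, the two terms of w + w' at v contribute the product of the
-- four incident signs, exactly like the closing terms of w and w' together.
module Submission where

open import Defs hiding (sym)
open import Data.Nat using (ℕ; zero; suc) renaming (_+_ to _+ℕ_)
open import Data.Nat.Properties using (+-assoc)
open import Data.Fin using (Fin; _≟_)
open import Data.Sign using (Sign; +; -; _*_)
open import Data.Sign.Properties using (*-assoc; *-comm; *-identityʳ; *-commutativeSemigroup)
open import Algebra.Properties.CommutativeSemigroup *-commutativeSemigroup using (interchange; xy∙z≈xz∙y)
open import Data.Empty using (⊥-elim)
open import Relation.Nullary using (yes; no; contradiction)
open import Relation.Binary.PropositionalEquality using (_≡_; refl; sym; cong; cong₂; module ≡-Reasoning)

open ≡-Reasoning

negOnePow-+ : ∀ a b → negOnePow (a +ℕ b) ≡ negOnePow a * negOnePow b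
negOnePow-+ zero    b = refl
negOnePow-+ (suc a) b = begin
  - * negOnePow (a +ℕ b)             ≡⟨ cong (- *_) (negOnePow-+ a b) ⟩
  - * (negOnePow a * negOnePow b)    ≡⟨ sym (*-assoc - (negOnePow a) (negOnePow b)) ⟩
  (- * negOnePow a) * negOnePow b    ∎

termSign : Sign → Sign → Sign
termSign s t = negOnePow (unb s t)

termSign≡-*s*t : ∀ s t → termSign s t ≡ - * (s * t)
termSign≡-*s*t + + = refl
termSign≡-*s*t + - = refl
termSign≡-*s*t - + = refl
termSign≡-*s*t - - = refl

termSign-exchange : ∀ a b c d → termSign a d * termSign c b ≡ termSign a b * termSign c d
termSign-exchange a b c d = begin
  termSign a d * termSign c b          ≡⟨ cong₂ _*_ (termSign≡-*s*t a d) (termSign≡-*s*t c b) ⟩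
  (- * (a * d)) * (- * (c * b))        ≡⟨ interchange - (a * d) - (c * b) ⟩
  (- * -) * ((a * d) * (c * b))        ≡⟨ cong ((- * -) *_) abcd ⟩
  (- * -) * ((a * b) * (c * d))        ≡⟨ sym (interchange - (a * b) - (c * d)) ⟩
  (- * (a * b)) * (- * (c * d))        ≡⟨ sym (cong₂ _*_ (termSign≡-*s*t a b) (termSign≡-*s*t c d)) ⟩
  termSign a b * termSign c d          ∎
  where
  abcd : (a * d) * (c * b) ≡ (a * b) * (c * d)
  abcd = begin
    (a * d) * (c * b)   ≡⟨ interchange a d c b ⟩
    (a * c) * (d * b)   ≡⟨ cong ((a * c) *_) (*-comm d b) ⟩
    (a * c) * (b * d)   ≡⟨ interchange a c b d ⟩
    (a * b) * (c * d)   ∎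

regroup : ∀ p q x y z w → x * y ≡ z * w → ((p * x) * q) * y ≡ (p * z) * (q * w)
regroup p q x y z w xy≡zw = begin
  ((p * x) * q) * y   ≡⟨ cong (_* y) (xy∙z≈xz∙y p x q) ⟩
  ((p * q) * x) * y   ≡⟨ *-assoc (p * q) x y ⟩
  (p * q) * (x * y)   ≡⟨ cong ((p * q) *_) xy≡zw ⟩
  (p * q) * (z * w)   ≡⟨ interchange p q z w ⟩
  (p * z) * (q * w)   ∎

++ʷ-identityʳ : ∀ {G u v} (p : Walk G u v) → p ++ʷ nil ≡ p
++ʷ-identityʳ nil        = refl
++ʷ-identityʳ (cons a p) = cong (cons a) (++ʷ-identityʳ p)

module _ (G : Graph) (τ : Signing G) where

  lastPrev-++ : ∀ {u w v y x} (a : Adj G u w) (p : Walk G w v) (b : Adj G v y) (q : Walk G y x) →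
                lastPrev u a (p ++ʷ cons b q) ≡ lastPrev v b q
  lastPrev-++ a nil        b q = refl
  lastPrev-++ a (cons c p) b q = lastPrev-++ c p b q

  internalUnb-++ : ∀ {u w v y x} (a : Adj G u w) (p : Walk G w v) (b : Adj G v y) (q : Walk G y x) →
                   internalUnb τ (cons a p ++ʷ cons b q)
                   ≡ internalUnb τ (cons a p) +ℕ unb (τ (lastPrev u a p) v) (τ y v) +ℕ internalUnb τ (cons b q)
  internalUnb-++ a nil b q = refl
  internalUnb-++ {u} {w} {v} {y} a (cons {_} {z} c p) b q = begin
    s +ℕ internalUnb τ (cons c p ++ʷ cons b q)   ≡⟨ cong (s +ℕ_) (internalUnb-++ c p b q) ⟩
    s +ℕ (i +ℕ j +ℕ k)                           ≡⟨ sym (+-assoc s (i +ℕ j) k) ⟩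
    s +ℕ (i +ℕ j) +ℕ k                           ≡⟨ cong (_+ℕ k) (sym (+-assoc s i j)) ⟩
    s +ℕ i +ℕ j +ℕ k                             ∎
    where
    s i j k : ℕ
    s = unb (τ u w) (τ z w)
    i = internalUnb τ (cons c p)
    j = unb (τ (lastPrev w c p) v) (τ y v)
    k = internalUnb τ (cons b q)

  internalSign : ∀ {u v} → Walk G u v → Sign
  internalSign p = negOnePow (internalUnb τ p)

  internalSign-++ : ∀ {u w v y x} (a : Adj G u w) (p : Walk G w v) (b : Adj G v y) (q : Walk G y x) →
                    internalSign (cons a p ++ʷ cons b q)
                    ≡ (internalSign (cons a p) * termSign (τ (lastPrev u a p) v) (τ y v)) * internalSign (cons b q)
  internalSign-++ {u} {w} {v} {y} a p b q = begin
    negOnePow (internalUnb τ (cons a p ++ʷ cons b q))   ≡⟨ cong negOnePow (internalUnb-++ a p b q) ⟩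
    negOnePow (i +ℕ j +ℕ k)                             ≡⟨ negOnePow-+ (i +ℕ j) k ⟩
    negOnePow (i +ℕ j) * negOnePow k                    ≡⟨ cong (_* negOnePow k) (negOnePow-+ i j) ⟩
    (negOnePow i * negOnePow j) * negOnePow k           ∎
    where
    i j k : ℕ
    i = internalUnb τ (cons a p)
    j = unb (τ (lastPrev u a p) v) (τ y v)
    k = internalUnb τ (cons b q)

  unbalancedCount-closed : ∀ {v} (p : Walk G v v) → unbalancedCount τ p ≡ internalUnb τ p +ℕ closingUnb τ p
  unbalancedCount-closed {v} p with v ≟ v
  ... | yes refl = refl
  ... | no v≢v   = contradiction refl v≢v

  μ-nil : ∀ v → μ τ (nil {u = v}) ≡ +
  μ-nil v = cong negOnePow (unbalancedCount-closed {v} nil)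

  closingUnb-cons : ∀ {v w} (a : Adj G v w) (p : Walk G w v) →
                    closingUnb τ (cons a p) ≡ unb (τ (lastPrev v a p) v) (τ w v)
  closingUnb-cons a nil        = ⊥-elim (irrefl G a)
  closingUnb-cons a (cons b p) = refl

  μ-closed : ∀ {v w} (a : Adj G v w) (p : Walk G w v) →
             μ τ (cons a p) ≡ internalSign (cons a p) * termSign (τ (lastPrev v a p) v) (τ w v)
  μ-closed {v} {w} a p = begin
    negOnePow (unbalancedCount τ (cons a p))
      ≡⟨ cong negOnePow (unbalancedCount-closed (cons a p)) ⟩
    negOnePow (internalUnb τ (cons a p) +ℕ closingUnb τ (cons a p))
      ≡⟨ negOnePow-+ (internalUnb τ (cons a p)) (closingUnb τ (cons a p)) ⟩
    internalSign (cons a p) * negOnePow (closingUnb τ (cons a p))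
      ≡⟨ cong (λ k → internalSign (cons a p) * negOnePow k) (closingUnb-cons a p) ⟩
    internalSign (cons a p) * termSign (τ (lastPrev v a p) v) (τ w v)
      ∎

lemma4p1 : (G : Graph) (τ : Signing G) {v : Fin (n G)}
    (w w' : Walk G v v) →
    μ τ (w ++ʷ w') ≡ μ τ w * μ τ w'
lemma4p1 G τ {v} nil w' = cong (_* μ τ w') (sym (μ-nil G τ v))
lemma4p1 G τ {v} w@(cons _ _) nil = begin
  μ τ (w ++ʷ nil)             ≡⟨ cong (μ τ) (++ʷ-identityʳ w) ⟩
  μ τ w                       ≡⟨ sym (*-identityʳ (μ τ w)) ⟩
  μ τ w * +                   ≡⟨ cong (μ τ w *_) (sym (μ-nil G τ v)) ⟩
  μ τ w * μ τ (nil {u = v})   ∎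
lemma4p1 G τ {v} (cons {_} {x} a p) (cons {_} {y} b q) = begin
  μ τ (cons a (p ++ʷ cons b q))
    ≡⟨ μ-closed G τ a (p ++ʷ cons b q) ⟩
  ι (cons a p ++ʷ cons b q) * termSign (τ (lastPrev v a (p ++ʷ cons b q)) v) startʷ
    ≡⟨ cong₂ _*_ (internalSign-++ G τ a p b q) (cong (λ z → termSign (τ z v) startʷ) (lastPrev-++ G τ a p b q)) ⟩
  ((ι (cons a p) * termSign endʷ startʷ′) * ι (cons b q)) * termSign endʷ′ startʷ
    ≡⟨ regroup (ι (cons a p)) (ι (cons b q)) _ _ _ _ (termSign-exchange endʷ startʷ endʷ′ startʷ′) ⟩
  (ι (cons a p) * termSign endʷ startʷ) * (ι (cons b q) * termSign endʷ′ startʷ′)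
    ≡⟨ sym (cong₂ _*_ (μ-closed G τ a p) (μ-closed G τ b q)) ⟩
  μ τ (cons a p) * μ τ (cons b q)
    ∎
  where
  ι : ∀ {u w} → Walk G u w → Sign
  ι = internalSign G τ

  startʷ startʷ′ endʷ endʷ′ : Sign
  startʷ  = τ x v
  startʷ′ = τ y v
  endʷ    = τ (lastPrev v a p) v
  endʷ′   = τ (lastPrev v b q) v
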